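{- For each $P\in\{P_1,P_2,P_3,P_4\}$ there exists a poset $X$ which is the image under a surjective p-morphism of a disjoint union of copies of $P$ and which is not Esakia representable.
   Context: A p-morphism between posets $X,Y$ is a map $f:X\to Y$ with ${\uparrow}f(x)=f({\uparrow}x)$ for all $x$, where ${\uparrow}x=\{y:x\le y\}$. An Esakia space is a triple $(X,\tau,\le)$ where $(X,\tau)$ is compact, Hausdorff and zero-dimensional, $\le$ is a partial order, each ${\uparrow}x$ is closed, and ${\downarrow}U=\{x:\exists u\in U,\ x\le u\}$ is clopen for every clopen $U$. A poset $(X,\le)$ is Esakia representable if there is a topology $\tau$ on $X$ making $(X,\tau,\le)$ an Esakia space. $P_1=\{0,a,b,c,1\}$ with $0<a,b,c<1$, $a,b,c$ pairwise incomparable; $P_2=\{0,a,b,c,1\}$ with $0<a<1$, $0<b<c<1$, $a$ incomparable to $b,c$; $P_3=\{r,a,b\}$ with $r<a$, $r<b$, $a,b$ incomparable; $P_4=\{0,a,b,c,d,1\}$ with $0<a,b$, each of $a,b$ below each of $c,d$, $c,d<1$, $a,b$ incomparable, $c,d$ incomparable. -}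

module Defs where

open import Level using (0ℓ)
open import Data.Product using (Σ; ∃; ∃-syntax; _×_; _,_; proj₁; proj₂)
open import Data.List using (List)
open import Data.Unit using (⊤)
open import Data.Empty using (⊥)
open import Data.List.Relation.Unary.Any using (Any)
open import Relation.Nullary using (¬_)
open import Relation.Binary.PropositionalEquality using (_≡_; refl; _≢_; cong₂)
open import Relation.Binary.Structures using (IsPartialOrder; IsPreorder)
open import Relation.Binary.PropositionalEquality.Properties using (isEquivalence)

record Pos : Set₁ where
  field
    Carrier : Set
    _≤_     : Carrier → Carrier → Set
    isPartialOrder : IsPartialOrder _≡_ _≤_

open Pos public

↑ : (P : Pos) → Carrier P → Carrier P → Set
↑ P x y = _≤_ P x y

-- p-morphism: ↑ f(x) = f(↑ x) (equality of subsets of Y, as mutual inclusion)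
IsPMorphism : (X Y : Pos) → (Carrier X → Carrier Y) → Set
IsPMorphism X Y f =
  (x : Carrier X) (y : Carrier Y) →
    (↑ Y (f x) y → ∃[ x' ] (↑ X x x' × f x' ≡ y))
  × (∃[ x' ] (↑ X x x' × f x' ≡ y) → ↑ Y (f x) y)

Surjective : {A B : Set} → (A → B) → Set
Surjective {A} {B} f = (b : B) → ∃[ a ] (f a ≡ b)

Copies : Set → Pos → Pos
Copies I P = record
  { Carrier = I × Carrier P
  ; _≤_ = λ u v → (proj₁ u ≡ proj₁ v) × (_≤_ P (proj₂ u) (proj₂ v))
  ; isPartialOrder = record
    { isPreorder = record
      { isEquivalence = isEquivalence
      ; reflexive = λ { refl → refl , IsPartialOrder.refl po }
      ; trans = λ { (refl , p) (refl , q) → refl , IsPartialOrder.trans po p q }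
      }
    ; antisym = λ { {i , p} {.i , q} (refl , p≤q) (_ , q≤p) →
                    cong₂ _,_ refl (IsPartialOrder.antisym po p≤q q≤p) }
    }
  }
  where po = isPartialOrder P

Subset : Set → Set₁
Subset X = X → Set

_⊆_ : {X : Set} → Subset X → Subset X → Set
U ⊆ V = ∀ x → U x → V x

record IsTopology (X : Set) (τ : Subset X → Set) : Set₁ where
  field
    ext   : ∀ U V → U ⊆ V → V ⊆ U → τ U → τ V
    whole : τ (λ _ → ⊤)
    inter : ∀ U V → τ U → τ V → τ (λ x → U x × V x)
    union : (J : Set) (U : J → Subset X) → (∀ j → τ (U j)) → τ (λ x → ∃[ j ] U j x)

module _ {X : Set} (τ : Subset X → Set) where

  Closed : Subset X → Set
  Closed C = τ (λ x → ¬ C x)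

  Clopen : Subset X → Set
  Clopen C = τ C × Closed C

  Compact : Set₁
  Compact = (J : Set) (U : J → Subset X) → (∀ j → τ (U j)) → (∀ x → ∃[ j ] U j x) →
            ∃[ js ] ((x : X) → Any (λ j → U j x) js)

  Hausdorff : Set₁
  Hausdorff = (x y : X) → x ≢ y →
    ∃[ U ] ∃[ V ] (τ U × τ V × U x × V y × ((z : X) → U z → V z → ⊥))

  ZeroDimensional : Set₁
  ZeroDimensional = (U : Subset X) → τ U → (x : X) → U x →
    ∃[ C ] (Clopen C × C x × C ⊆ U)

IsEsakiaSpace : (P : Pos) → (Subset (Carrier P) → Set) → Set₁
IsEsakiaSpace P τ =
    IsTopology (Carrier P) τ
  × Compact τ
  × Hausdorff τ
  × ZeroDimensional τ
  × ((x : Carrier P) → Closed τ (↑ P x))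
  × ((U : Subset (Carrier P)) → Clopen τ U →
       Clopen τ (λ x → ∃[ u ] (U u × _≤_ P x u)))

EsakiaRepresentable : Pos → Set₁
EsakiaRepresentable P = ∃[ τ ] IsEsakiaSpace P τ

data E₁ : Set where z a b c o : E₁

data _≤₁_ : E₁ → E₁ → Set where
  rfl : ∀ {x} → x ≤₁ x
  bot : ∀ {x} → z ≤₁ x
  top : ∀ {x} → x ≤₁ o

P₁ : Pos
P₁ = record { Carrier = E₁ ; _≤_ = _≤₁_ ; isPartialOrder = record
  { isPreorder = record { isEquivalence = isEquivalence
    ; reflexive = λ { refl → rfl } ; trans = tr }
  ; antisym = an } }
  where
  tr : ∀ {x y w} → x ≤₁ y → y ≤₁ w → x ≤₁ w
  tr rfl q = q
  tr p rfl = p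
  tr bot _ = bot
  tr _ top = top
  an : ∀ {x y} → x ≤₁ y → y ≤₁ x → x ≡ y
  an rfl _ = refl
  an _ rfl = refl
  an bot bot = refl
  an top top = refl

data _≤₂_ : E₁ → E₁ → Set where
  rfl : ∀ {x} → x ≤₂ x
  bot : ∀ {x} → z ≤₂ x
  top : ∀ {x} → x ≤₂ o
  bc  : b ≤₂ c

P₂ : Pos
P₂ = record { Carrier = E₁ ; _≤_ = _≤₂_ ; isPartialOrder = record
  { isPreorder = record { isEquivalence = isEquivalence
    ; reflexive = λ { refl → rfl } ; trans = tr }
  ; antisym = an } }
  where
  tr : ∀ {x y w} → x ≤₂ y → y ≤₂ w → x ≤₂ w
  tr rfl q = q
  tr p rfl = p
  tr bot _ = bot
  tr _ top = top
  an : ∀ {x y} → x ≤₂ y → y ≤₂ x → x ≡ y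
  an rfl _ = refl
  an _ rfl = refl
  an bot bot = refl
  an top top = refl

data E₃ : Set where r a b : E₃

data _≤₃_ : E₃ → E₃ → Set where
  rfl : ∀ {x} → x ≤₃ x
  bot : ∀ {x} → r ≤₃ x

P₃ : Pos
P₃ = record { Carrier = E₃ ; _≤_ = _≤₃_ ; isPartialOrder = record
  { isPreorder = record { isEquivalence = isEquivalence
    ; reflexive = λ { refl → rfl } ; trans = tr }
  ; antisym = an } }
  where
  tr : ∀ {x y w} → x ≤₃ y → y ≤₃ w → x ≤₃ w
  tr rfl q = q
  tr bot _ = bot
  an : ∀ {x y} → x ≤₃ y → y ≤₃ x → x ≡ y
  an rfl _ = refl
  an bot rfl = refl
  an bot bot = refl

data E₄ : Set where z a b c d o : E₄

data _≤₄_ : E₄ → E₄ → Set where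
  rfl : ∀ {x} → x ≤₄ x
  bot : ∀ {x} → z ≤₄ x
  top : ∀ {x} → x ≤₄ o
  ac  : a ≤₄ c
  ad  : a ≤₄ d
  bc  : b ≤₄ c
  bd  : b ≤₄ d

P₄ : Pos
P₄ = record { Carrier = E₄ ; _≤_ = _≤₄_ ; isPartialOrder = record
  { isPreorder = record { isEquivalence = isEquivalence
    ; reflexive = λ { refl → rfl } ; trans = tr }
  ; antisym = an } }
  where
  tr : ∀ {x y w} → x ≤₄ y → y ≤₄ w → x ≤₄ w
  tr rfl q = q
  tr p rfl = p
  tr bot _ = bot
  tr _ top = top
  an : ∀ {x y} → x ≤₄ y → y ≤₄ x → x ≡ y
  an rfl _ = refl
  an _ rfl = refl
  an bot bot = refl
  an top top = refl

Claim : Pos → Set₁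
Claim P = ∃[ X ] ∃[ I ] ∃[ f ]
  (IsPMorphism (Copies I P) X f × Surjective f × ¬ EsakiaRepresentable X)

-- Each P consists of a least element, two incomparable atoms "left" and "right", and a finite
-- upper part. Collapse ℕ × ℕ copies of P: the bottom of copy (m , k) stays private, its left atom
-- is glued to those of all copies with the same m + k, its right atom to those of all copies with
-- the same m, and the upper part is shared. In an Esakia topology on the result, every point x
-- has a neighbourhood missing a tail of the sequence left n, contradicting compactness. Below
-- right m lie only the bottoms (m , k), and above (m , k) the only point outside ↓ right m and the
-- upper part is left (m + k). Using Priestley separation and Hausdorffness, every point y gets an
-- open O ∋ y and an open V ∋ x such that no bottom (m , k) in O has left (m + k) in V; a finite
-- subcover by the sets O gives a neighbourhood of x that misses every left (m + k).
module Submission where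

open import Defs
open import Data.Empty using (⊥; ⊥-elim)
open import Data.List using (List; []; _∷_; map)
open import Data.List.Extrema.Nat using (max; xs≤max)
open import Data.List.Membership.Propositional using (_∈_)
open import Data.List.Relation.Unary.All as All using (All; []; _∷_)
open import Data.List.Relation.Unary.All.Properties using (map⁻)
open import Data.List.Relation.Unary.Any as Any using (Any; here; there)
open import Data.Nat using (ℕ; suc; _+_; _∸_; _≟_; s≤s)
open import Data.Nat.Properties using (m+[n∸m]≡n; m≤m+n; >⇒≢)
open import Data.Product using (_×_; _,_; proj₁; proj₂; ∃-syntax)
open import Data.Sum using (_⊎_; inj₁; inj₂)
open import Data.Unit using (⊤; tt)
open import Function using (_∘_)
open import Relation.Nullary using (¬_; yes; no)
open import Relation.Binary.PropositionalEquality using (_≡_; _≢_; refl; sym; trans; cong; subst; subst₂)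
open import Relation.Binary.Structures using (IsPartialOrder)
open import Relation.Binary.PropositionalEquality.Properties using (isEquivalence)

module Topology {X : Set} {τ : Subset X → Set} (open-sets : IsTopology X τ) where
  open IsTopology open-sets

  _∩_ : Subset X → Subset X → Subset X
  (U ∩ V) x = U x × V x

  ⋂-open : {J : Set} (U : J → Subset X) → (∀ j → τ (U j)) → (js : List J) →
           τ (λ x → All (λ j → U j x) js)
  ⋂-open U U-open [] = ext (λ _ → ⊤) _ (λ _ _ → []) (λ _ _ → tt) whole
  ⋂-open U U-open (j ∷ js) =
    ext (U j ∩ _) _ (λ { _ (p , ps) → p ∷ ps }) (λ { _ (p ∷ ps) → p , ps })
        (inter _ _ (U-open j) (⋂-open U U-open js))

  record NbhdAvoiding (x : X) (s : ℕ → X) : Set₁ where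
    field
      V : Subset X
      V-open : τ V
      x∈V : V x
      avoids : ∀ k → ¬ V (s k)

  compact⇒¬tail-avoiding : Compact τ → (s : ℕ → X) →
                           ¬ (∀ x → ∃[ m ] NbhdAvoiding x (λ k → s (m + k)))
  compact⇒¬tail-avoiding compact s local = uncovered (compact X V V-open (λ x → x , x∈V x))
    where
    module Nbhd (x : X) = NbhdAvoiding (proj₂ (local x))
    open Nbhd
    start : X → ℕ
    start x = proj₁ (local x)
    uncovered : ∃[ ys ] ((x : X) → Any (λ y → V y x) ys) → ⊥
    uncovered (ys , covers) =
      let n = max 0 (map start ys)
          y = Any.lookup (covers (s n))
          (start≤n , sn∈V) = All.lookupAny (map⁻ (xs≤max 0 (map start ys))) (covers (s n))
      in avoids y (n ∸ start y) (subst (λ i → V y (s i)) (sym (m+[n∸m]≡n start≤n)) sn∈V)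

  record SeparatingPair (x : X) (φ ψ : ℕ → X) (y : X) : Set₁ where
    field
      O V : Subset X
      O-open : τ O
      V-open : τ V
      y∈O : O y
      x∈V : V x
      separates : ∀ k → O (ψ k) → ¬ V (φ k)

  separated⇒avoiding : Compact τ → ∀ {x φ ψ} → (∀ y → SeparatingPair x φ ψ y) →
                       NbhdAvoiding x φ
  separated⇒avoiding compact {x} {φ} {ψ} pair =
    avoiding (compact X (O ∘ pair) (O-open ∘ pair) (λ y → y , y∈O (pair y)))
    where
    open SeparatingPair
    avoiding : ∃[ ys ] ((y : X) → Any (λ y' → O (pair y') y) ys) → NbhdAvoiding x φ
    avoiding (ys , covers) = record
      { V = λ v → All (λ y → V (pair y) v) ys
      ; V-open = ⋂-open (V ∘ pair) (V-open ∘ pair) ys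
      ; x∈V = All.tabulate (λ {y} _ → x∈V (pair y))
      ; avoids = λ k φ∈V →
          let (φ∈Vy , ψ∈Oy) = All.lookupAny φ∈V (covers (ψ k))
          in separates (pair (Any.lookup (covers (ψ k)))) k ψ∈Oy φ∈Vy
      }

module EsakiaSpace (P : Pos) {τ : Subset (Carrier P) → Set}
  (open-sets : IsTopology (Carrier P) τ) (compact : Compact τ) (hausdorff : Hausdorff τ)
  (zero-dim : ZeroDimensional τ) (↑-closed : ∀ x → Closed τ (↑ P x))
  (↓-clopen : ∀ C → Clopen τ C → Clopen τ (λ x → ∃[ u ] (C u × _≤_ P x u)))
  where

  open Pos P using () renaming (Carrier to X; _≤_ to _⊑_)
  open IsPartialOrder (isPartialOrder P) using () renaming (refl to ⊑-refl; trans to ⊑-trans)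
  open IsTopology open-sets using (whole; inter)
  open Topology open-sets

  ↓ : Subset X → Subset X
  ↓ C x = ∃[ u ] (C u × x ⊑ u)

  ↓-downward : ∀ {C x y} → x ⊑ y → ↓ C y → ↓ C x
  ↓-downward x⊑y (u , u∈C , y⊑u) = u , u∈C , ⊑-trans x⊑y y⊑u

  priestley-separation : ∀ {x y} → ¬ x ⊑ y → ∃[ C ] (Clopen τ (↓ C) × ↓ C y × ¬ ↓ C x)
  priestley-separation {x} {y} x⋢y with zero-dim (λ v → ¬ x ⊑ v) (↑-closed x) y x⋢y
  ... | C , C-clopen , y∈C , C⊆↑xᶜ =
    C , ↓-clopen C C-clopen , (y , y∈C , ⊑-refl) , λ (u , u∈C , x⊑u) → C⊆↑xᶜ u u∈C x⊑u

  separate-from-↓ : ∀ {x w} → ¬ x ⊑ w → ∃[ O ] (τ O × O x × ∀ {v} → v ⊑ w → ¬ O v)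
  separate-from-↓ x⋢w with priestley-separation x⋢w
  ... | C , (_ , ↓C-closed) , w∈↓C , x∉↓C =
    (λ v → ¬ ↓ C v) , ↓C-closed , x∉↓C , λ v⊑w v∉↓C → v∉↓C (↓-downward v⊑w w∈↓C)

  avoiding-below : ∀ {x w s} → ¬ x ⊑ w → (∀ k → s k ⊑ w) → NbhdAvoiding x s
  avoiding-below x⋢w s⊑w with separate-from-↓ x⋢w
  ... | O , O-open , x∈O , O∩↓w=∅ =
    record { V = O ; V-open = O-open ; x∈V = x∈O ; avoids = λ k → O∩↓w=∅ (s⊑w k) }

  module _ {x : X} {φ ψ : ℕ → X} where

    separating-by-bound : ∀ {y w} → ¬ y ⊑ w → (∀ k → ψ k ⊑ w) → SeparatingPair x φ ψ y
    separating-by-bound y⋢w ψ⊑w = record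
      { O = V ; V = λ _ → ⊤ ; O-open = V-open ; V-open = whole ; y∈O = x∈V ; x∈V = tt
      ; separates = λ k ψ∈O _ → avoids k ψ∈O }
      where open NbhdAvoiding (avoiding-below y⋢w ψ⊑w)

    separating-by-downset : ∀ {y} → ¬ y ⊑ x → (∀ k → ψ k ⊑ φ k) → SeparatingPair x φ ψ y
    separating-by-downset y⋢x ψ⊑φ with priestley-separation y⋢x
    ... | C , (↓C-open , ↓C-closed) , x∈↓C , y∉↓C = record
      { O = λ v → ¬ ↓ C v ; V = ↓ C ; O-open = ↓C-closed ; V-open = ↓C-open
      ; y∈O = y∉↓C ; x∈V = x∈↓C
      ; separates = λ k ψ∉↓C φ∈↓C → ψ∉↓C (↓-downward (ψ⊑φ k) φ∈↓C) }

  record Fan : Set₁ where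
    field
      apex : X
      base tip : ℕ → X
      base⊑apex : ∀ k → base k ⊑ apex
      base⊑tip : ∀ k → base k ⊑ tip k
      tip⋢apex : ∀ k → ¬ tip k ⊑ apex
      below-apex : ∀ y → ¬ y ⊑ apex ⊎ y ≡ apex ⊎ ∃[ k ] y ≡ base k
      Window : Subset X
      window-open : τ Window
      tip∈window : ∀ k → Window (tip k)
      window-isolates : ∀ {k w} → base k ⊑ w → Window w → ¬ w ⊑ apex → w ≡ tip k

  module _ (F : Fan) where
    open Fan F

    separating-base : ∀ {x} k → tip k ≢ x → SeparatingPair x tip base (base k)
    separating-base {x} k tip≢x with hausdorff (tip k) x tip≢x | separate-from-↓ (tip⋢apex k)
    ... | U , W , U-open , W-open , tip∈U , x∈W , U∩W=∅ | O , O-open , tip∈O , O∩↓apex=∅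
      with zero-dim (U ∩ (O ∩ Window)) (inter _ _ U-open (inter _ _ O-open window-open))
                    (tip k) (tip∈U , tip∈O , tip∈window k)
    ... | C , C-clopen , tip∈C , C⊆ = record
      { O = ↓ C ; V = W ; O-open = proj₁ (↓-clopen C C-clopen) ; V-open = W-open
      ; y∈O = tip k , tip∈C , base⊑tip k ; x∈V = x∈W
      ; separates = λ { j (u , u∈C , base⊑u) tip∈W →
          let (u∈U , u∈O , u∈window) = C⊆ u u∈C
              u≡tip = window-isolates base⊑u u∈window (λ u⊑apex → O∩↓apex=∅ u⊑apex u∈O)
          in U∩W=∅ (tip j) (subst U u≡tip u∈U) tip∈W } }

    separating-apex : ∀ {x} → ¬ apex ⊑ x ⊎ ∃[ w ] (¬ apex ⊑ w × ∀ k → base k ⊑ w) →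
                      SeparatingPair x tip base apex
    separating-apex (inj₁ apex⋢x) = separating-by-downset apex⋢x base⊑tip
    separating-apex (inj₂ (w , apex⋢w , base⊑w)) = separating-by-bound apex⋢w base⊑w

    fan-avoiding : ∀ {x} → (∀ k → tip k ≢ x) →
                   ¬ apex ⊑ x ⊎ ∃[ w ] (¬ apex ⊑ w × ∀ k → base k ⊑ w) → NbhdAvoiding x tip
    fan-avoiding {x} tip≢x apex-separated = separated⇒avoiding compact pair
      where
      pair : ∀ y → SeparatingPair x tip base y
      pair y with below-apex y
      ... | inj₁ y⋢apex = separating-by-bound y⋢apex base⊑apex
      ... | inj₂ (inj₁ refl) = separating-apex apex-separated
      ... | inj₂ (inj₂ (k , refl)) = separating-base k (tip≢x k)

data Role (Upper : Set) : Set where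
  bottom left right : Role Upper
  upper : Upper → Role Upper

module _ (P : Pos) where
  open Pos P using () renaming (Carrier to |P|; _≤_ to _≤ₚ_)

  record Shape : Set₁ where
    field
      Upper : Set
      uppers : List Upper
      upper∈uppers : ∀ t → t ∈ uppers
      point : Role Upper → |P|
      role : |P| → Role Upper
      point-role : ∀ p → point (role p) ≡ p
      role-point : ∀ ρ → role (point ρ) ≡ ρ
      bottom-least : ∀ p → point bottom ≤ₚ p
      left⋢right : ¬ point left ≤ₚ point right
      right⋢left : ¬ point right ≤ₚ point left
      upper⋢left : ∀ t → ¬ point (upper t) ≤ₚ point left
      upper⋢right : ∀ t → ¬ point (upper t) ≤ₚ point right
      -- How upper points are kept away from the left atoms: either some upper point is not above
      -- the right atom, or each upper point t is not below some upper point t' above the left atom.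
      escape : ∃[ t ] ¬ point right ≤ₚ point (upper t)
             ⊎ (∀ t → ∃[ t' ] (point left ≤ₚ point (upper t')
                               × ¬ point (upper t) ≤ₚ point (upper t')))

module Collapse {P : Pos} (S : Shape P) where
  open Shape S
  open Pos P using () renaming (Carrier to |P|; _≤_ to _≤ₚ_)
  open IsPartialOrder (isPartialOrder P) using ()
    renaming (refl to ≤ₚ-refl; trans to ≤ₚ-trans; antisym to ≤ₚ-antisym)

  point-injective : ∀ {ρ ρ'} → point ρ ≡ point ρ' → ρ ≡ ρ'
  point-injective {ρ} {ρ'} eq = trans (sym (role-point ρ)) (trans (cong role eq) (role-point ρ'))

  ≤bottom⇒bottom : ∀ {ρ} → point ρ ≤ₚ point bottom → ρ ≡ bottom
  ≤bottom⇒bottom le = point-injective (≤ₚ-antisym le (bottom-least _))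

  data Point : Set where
    bottom : ℕ → ℕ → Point
    left right : ℕ → Point
    upper : Upper → Point

  data _≼_ : Point → Point → Set where
    rfl : ∀ {x} → x ≼ x
    bottom≼left : ∀ {m k n} → m + k ≡ n → bottom m k ≼ left n
    bottom≼right : ∀ {m k} → bottom m k ≼ right m
    bottom≼upper : ∀ {m k t} → bottom m k ≼ upper t
    left≼upper : ∀ {n t} → point left ≤ₚ point (upper t) → left n ≼ upper t
    right≼upper : ∀ {m t} → point right ≤ₚ point (upper t) → right m ≼ upper t
    upper≼upper : ∀ {t t'} → point (upper t) ≤ₚ point (upper t') → upper t ≼ upper t'

  ≼-trans : ∀ {x y z} → x ≼ y → y ≼ z → x ≼ z
  ≼-trans rfl q = q
  ≼-trans p rfl = p
  ≼-trans (bottom≼left _) (left≼upper _) = bottom≼upper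
  ≼-trans bottom≼right (right≼upper _) = bottom≼upper
  ≼-trans bottom≼upper (upper≼upper _) = bottom≼upper
  ≼-trans (left≼upper p) (upper≼upper q) = left≼upper (≤ₚ-trans p q)
  ≼-trans (right≼upper p) (upper≼upper q) = right≼upper (≤ₚ-trans p q)
  ≼-trans (upper≼upper p) (upper≼upper q) = upper≼upper (≤ₚ-trans p q)

  ≼-antisym : ∀ {x y} → x ≼ y → y ≼ x → x ≡ y
  ≼-antisym rfl _ = refl
  ≼-antisym (upper≼upper _) rfl = refl
  ≼-antisym (upper≼upper p) (upper≼upper q) =
    cong upper (upper-injective (point-injective (≤ₚ-antisym p q)))
    where
    upper-injective : ∀ {t t'} → Role.upper t ≡ upper t' → t ≡ t'
    upper-injective refl = refl

  Collapsed : Pos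
  Collapsed = record
    { Carrier = Point ; _≤_ = _≼_ ; isPartialOrder = record
      { isPreorder = record
        { isEquivalence = isEquivalence ; reflexive = λ { refl → rfl } ; trans = ≼-trans }
      ; antisym = ≼-antisym } }

  collapse : ℕ × ℕ → Role Upper → Point
  collapse (m , k) bottom = bottom m k
  collapse (m , k) left = left (m + k)
  collapse (m , k) right = right m
  collapse _ (upper t) = upper t

  collapse-mono : ∀ i {ρ ρ'} → point ρ ≤ₚ point ρ' → collapse i ρ ≼ collapse i ρ'
  collapse-mono i {bottom} {bottom} _ = rfl
  collapse-mono i {bottom} {left} _ = bottom≼left refl
  collapse-mono i {bottom} {right} _ = bottom≼right
  collapse-mono i {bottom} {upper _} _ = bottom≼upper
  collapse-mono i {left} {bottom} le with () ← ≤bottom⇒bottom le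
  collapse-mono i {left} {left} _ = rfl
  collapse-mono i {left} {right} le = ⊥-elim (left⋢right le)
  collapse-mono i {left} {upper _} le = left≼upper le
  collapse-mono i {right} {bottom} le with () ← ≤bottom⇒bottom le
  collapse-mono i {right} {left} le = ⊥-elim (right⋢left le)
  collapse-mono i {right} {right} _ = rfl
  collapse-mono i {right} {upper _} le = right≼upper le
  collapse-mono i {upper _} {bottom} le with () ← ≤bottom⇒bottom le
  collapse-mono i {upper t} {left} le = ⊥-elim (upper⋢left t le)
  collapse-mono i {upper t} {right} le = ⊥-elim (upper⋢right t le)
  collapse-mono i {upper _} {upper _} le = upper≼upper le

  collapse-lift : ∀ i ρ {y} → collapse i ρ ≼ y → ∃[ ρ' ] (point ρ ≤ₚ point ρ' × collapse i ρ' ≡ y)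
  collapse-lift (m , k) bottom (bottom≼left m+k≡n) = left , bottom-least _ , cong left m+k≡n
  collapse-lift (m , k) bottom bottom≼right = right , bottom-least _ , refl
  collapse-lift (m , k) bottom (bottom≼upper {t = t}) = upper t , bottom-least _ , refl
  collapse-lift (m , k) left (left≼upper {t = t} le) = upper t , le , refl
  collapse-lift (m , k) right (right≼upper {t = t} le) = upper t , le , refl
  collapse-lift _ (upper _) (upper≼upper {t' = t'} le) = upper t' , le , refl
  collapse-lift _ ρ rfl = ρ , ≤ₚ-refl , refl

  π : Carrier (Copies (ℕ × ℕ) P) → Point
  π (i , p) = collapse i (role p)

  π-pmorphism : IsPMorphism (Copies (ℕ × ℕ) P) Collapsed π
  π-pmorphism (i , p) y = lift , descend
    where
    lift : π (i , p) ≼ y → ∃[ x' ] ((i ≡ proj₁ x' × p ≤ₚ proj₂ x') × π x' ≡ y)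
    lift le with collapse-lift i (role p) le
    ... | ρ' , p≤ρ' , refl =
      (i , point ρ') , (refl , subst (_≤ₚ point ρ') (point-role p) p≤ρ') ,
      cong (collapse i) (role-point ρ')
    descend : ∃[ x' ] ((i ≡ proj₁ x' × p ≤ₚ proj₂ x') × π x' ≡ y) → π (i , p) ≼ y
    descend ((.i , p') , (refl , p≤p') , refl) =
      collapse-mono i (subst₂ _≤ₚ_ (sym (point-role p)) (sym (point-role p')) p≤p')

  collapse-surjective : ∀ x → ∃[ i ] ∃[ ρ ] collapse i ρ ≡ x
  collapse-surjective (bottom m k) = (m , k) , bottom , refl
  collapse-surjective (left n) = (0 , n) , left , refl
  collapse-surjective (right m) = (m , 0) , right , refl
  collapse-surjective (upper t) = (0 , 0) , upper t , refl

  π-surjective : Surjective π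
  π-surjective x =
    let (i , ρ , collapse≡x) = collapse-surjective x
    in (i , point ρ) , trans (cong (collapse i) (role-point ρ)) collapse≡x

  left-injective : ∀ {m n} → Point.left m ≡ left n → m ≡ n
  left-injective refl = refl

  upper⋢upper : ∀ {t t'} → ¬ point (upper t) ≤ₚ point (upper t') → ¬ upper t ≼ upper t'
  upper⋢upper t⋢t' rfl = t⋢t' ≤ₚ-refl
  upper⋢upper t⋢t' (upper≼upper le) = t⋢t' le

  collapsed-not-representable : ¬ EsakiaRepresentable Collapsed
  collapsed-not-representable
    (τ , open-sets , compact , hausdorff , zero-dim , ↑-closed , ↓-clopen) =
    compact⇒¬tail-avoiding compact left tail-avoiding
    where
    open Topology open-sets
    open EsakiaSpace Collapsed open-sets compact hausdorff zero-dim ↑-closed ↓-clopen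

    fan : ℕ → Fan
    fan m = record
      { apex = right m ; base = bottom m ; tip = λ k → left (m + k)
      ; base⊑apex = λ _ → bottom≼right ; base⊑tip = λ _ → bottom≼left refl ; tip⋢apex = λ _ ()
      ; below-apex = below-apex
      ; Window = λ w → All (λ t → ¬ upper t ≼ w) uppers
      ; window-open = ⋂-open (λ t w → ¬ upper t ≼ w) (λ t → ↑-closed (upper t)) uppers
      ; tip∈window = λ _ → All.tabulate (λ _ ())
      ; window-isolates = window-isolates }
      where
      below-apex : ∀ y → ¬ y ≼ right m ⊎ y ≡ right m ⊎ ∃[ k ] y ≡ bottom m k
      below-apex (bottom n k) with n ≟ m
      ... | yes refl = inj₂ (inj₂ (k , refl))
      ... | no n≢m = inj₁ λ { bottom≼right → n≢m refl }
      below-apex (left _) = inj₁ λ ()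
      below-apex (right n) with n ≟ m
      ... | yes refl = inj₂ (inj₁ refl)
      ... | no n≢m = inj₁ λ { rfl → n≢m refl }
      below-apex (upper _) = inj₁ λ ()
      window-isolates : ∀ {k w} → bottom m k ≼ w → All (λ t → ¬ upper t ≼ w) uppers →
                        ¬ w ≼ right m → w ≡ left (m + k)
      window-isolates rfl _ w⋢apex = ⊥-elim (w⋢apex bottom≼right)
      window-isolates (bottom≼left m+k≡n) _ _ = cong left (sym m+k≡n)
      window-isolates bottom≼right _ w⋢apex = ⊥-elim (w⋢apex rfl)
      window-isolates (bottom≼upper {t = t}) w∈window _ =
        ⊥-elim (All.lookup w∈window (upper∈uppers t) rfl)

    tail-avoiding : ∀ x → ∃[ m ] NbhdAvoiding x (λ k → left (m + k))
    tail-avoiding (bottom _ _) = 0 , fan-avoiding (fan 0) (λ _ ()) (inj₁ λ ())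
    tail-avoiding (left n) =
      suc n , fan-avoiding (fan (suc n)) (λ k eq → >⇒≢ (s≤s (m≤m+n n k)) (left-injective eq))
                           (inj₁ λ ())
    tail-avoiding (right n) = suc n , fan-avoiding (fan (suc n)) (λ _ ()) (inj₁ λ ())
    tail-avoiding (upper t) with escape
    ... | inj₁ (t₀ , right⋢t₀) =
      0 , fan-avoiding (fan 0) (λ _ ())
            (inj₂ (upper t₀ , (λ { (right≼upper le) → right⋢t₀ le }) , λ _ → bottom≼upper))
    ... | inj₂ above = let (t' , left≤t' , t⋢t') = above t in
      0 , avoiding-below (upper⋢upper t⋢t') (λ _ → left≼upper left≤t')

  shape⇒claim : Claim P
  shape⇒claim = Collapsed , (ℕ × ℕ) , π , π-pmorphism , π-surjective , collapsed-not-representable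

open Collapse using (shape⇒claim)

data Upper₁ : Set where
  c o : Upper₁

data Upper₄ : Set where
  c d o : Upper₄

shape₁ : Shape P₁
shape₁ = record
  { Upper = Upper₁ ; uppers = c ∷ o ∷ [] ; upper∈uppers = λ { c → here refl ; o → there (here refl) }
  ; point = λ { bottom → z ; left → a ; right → b ; (upper c) → c ; (upper o) → o }
  ; role = λ { z → bottom ; a → left ; b → right ; c → upper c ; o → upper o }
  ; point-role = λ { z → refl ; a → refl ; b → refl ; c → refl ; o → refl }
  ; role-point = λ { bottom → refl ; left → refl ; right → refl ; (upper c) → refl ; (upper o) → refl }
  ; bottom-least = λ _ → bot
  ; left⋢right = λ () ; right⋢left = λ ()
  ; upper⋢left = λ { c () ; o () } ; upper⋢right = λ { c () ; o () }
  ; escape = inj₁ (c , λ ()) }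

shape₂ : Shape P₂
shape₂ = record
  { Upper = Upper₁ ; uppers = c ∷ o ∷ [] ; upper∈uppers = λ { c → here refl ; o → there (here refl) }
  ; point = λ { bottom → z ; left → b ; right → a ; (upper c) → c ; (upper o) → o }
  ; role = λ { z → bottom ; a → right ; b → left ; c → upper c ; o → upper o }
  ; point-role = λ { z → refl ; a → refl ; b → refl ; c → refl ; o → refl }
  ; role-point = λ { bottom → refl ; left → refl ; right → refl ; (upper c) → refl ; (upper o) → refl }
  ; bottom-least = λ _ → bot
  ; left⋢right = λ () ; right⋢left = λ ()
  ; upper⋢left = λ { c () ; o () } ; upper⋢right = λ { c () ; o () }
  ; escape = inj₁ (c , λ ()) }

shape₃ : Shape P₃
shape₃ = record
  { Upper = ⊥ ; uppers = [] ; upper∈uppers = λ ()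
  ; point = λ { bottom → r ; left → a ; right → b ; (upper ()) }
  ; role = λ { r → bottom ; a → left ; b → right }
  ; point-role = λ { r → refl ; a → refl ; b → refl }
  ; role-point = λ { bottom → refl ; left → refl ; right → refl ; (upper ()) }
  ; bottom-least = λ _ → bot
  ; left⋢right = λ () ; right⋢left = λ ()
  ; upper⋢left = λ () ; upper⋢right = λ ()
  ; escape = inj₂ λ () }

shape₄ : Shape P₄
shape₄ = record
  { Upper = Upper₄ ; uppers = c ∷ d ∷ o ∷ []
  ; upper∈uppers = λ { c → here refl ; d → there (here refl) ; o → there (there (here refl)) }
  ; point = λ { bottom → z ; left → a ; right → b ; (upper c) → c ; (upper d) → d ; (upper o) → o }
  ; role = λ { z → bottom ; a → left ; b → right ; c → upper c ; d → upper d ; o → upper o }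
  ; point-role = λ { z → refl ; a → refl ; b → refl ; c → refl ; d → refl ; o → refl }
  ; role-point = λ { bottom → refl ; left → refl ; right → refl
                   ; (upper c) → refl ; (upper d) → refl ; (upper o) → refl }
  ; bottom-least = λ _ → bot
  ; left⋢right = λ () ; right⋢left = λ ()
  ; upper⋢left = λ { c () ; d () ; o () } ; upper⋢right = λ { c () ; d () ; o () }
  ; escape = inj₂ λ { c → d , ad , λ () ; d → c , ac , λ () ; o → c , ac , λ () } }

proposition5p2 : Claim P₁ × Claim P₂ × Claim P₃ × Claim P₄
proposition5p2 = shape⇒claim shape₁ , shape⇒claim shape₂ , shape⇒claim shape₃ , shape⇒claim shape₄
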